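{- Let $x\in\Sigma^*$ and let $\sigma$ be a finite sequence of channel actions. The following are equivalent: (i) for every $k\in\mathbb{N}$ there exists $x_k$ with $x\xrightarrow{\sigma^*}x_k$ and $|x_k|\ge k$; (ii) there exists an infinite sequence $x\xrightarrow{\sigma^*}x_1\xrightarrow{\sigma^*}x_2\xrightarrow{\sigma^*}\cdots$ with $|x_1|<|x_2|<\cdots$; (iii) $\sigma$ is increasing, $\mathrm{pr}[\sigma^\omega](\epsilon)\neq\bot$, and $\mathrm{pr}[\sigma^\omega](\epsilon)\sqsubseteq x$.
   Context: Channel actions over finite $\Sigma$ are $!w$, $?w$; $\mathrm{rea}(?w)=w$, $\mathrm{rea}(!w)=\epsilon$, $\mathrm{wri}(!w)=w$, $\mathrm{wri}(?w)=\epsilon$, extended by concatenation. Lossy semantics: $x\xrightarrow{!w}y$ iff $y\sqsubseteq xw$, $x\xrightarrow{?w}y$ iff $wy\sqsubseteq x$ ($\sqsubseteq$ scattered subword), extended to sequences; $x\xrightarrow{\sigma^*}y$ means $x\xrightarrow{\sigma^n}y$ for some $n\in\mathbb{N}$. $\sigma$ is increasing if, with $u=\mathrm{rea}(\sigma)$, $v=\mathrm{wri}(\sigma)$, $\ell_v=|v|$, one has $\ell_v>0$ and $u^{\ell_v}\sqsubseteq v^{\ell_v-1}$. $\uparrow y=\{z:y\sqsubseteq z\}$, $\mathrm{Pre}[\sigma](T)=\{z:\exists t\in T,\ z\xrightarrow{\sigma}t\}$, $I_\sigma=\bigcap_{k\in\mathbb{N}}\mathrm{Pre}[\sigma^k](\Sigma^*)$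 (empty or $\uparrow y$ for a unique $y$); $\mathrm{pr}[\sigma^\omega](\epsilon)=y$ if $I_\sigma=\uparrow y$ and $=\bot$ if $I_\sigma=\emptyset$. -}

module Defs where

open import Data.Nat using (ℕ; zero; suc; _+_; _∸_; _<_)
open import Data.Fin using (Fin)
open import Data.List using (List; []; _∷_; _++_; concat; replicate)
open import Data.Product using (Σ; ∃; _×_)
open import Data.Unit using (⊤)
import Data.List.Relation.Binary.Sublist.Propositional as SL

module _ {n : ℕ} where

  Word : Set
  Word = List (Fin n)

  _⊑_ : Word → Word → Set
  x ⊑ y = SL._⊆_ x y

  data Action : Set where
    !_ : Word → Action
    ¿_ : Word → Action

  rea₁ : Action → Word
  rea₁ (! w) = []
  rea₁ (¿ w) = w

  wri₁ : Action → Word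
  wri₁ (! w) = w
  wri₁ (¿ w) = []

  rea : List Action → Word
  rea []      = []
  rea (a ∷ σ) = rea₁ a ++ rea σ

  wri : List Action → Word
  wri []      = []
  wri (a ∷ σ) = wri₁ a ++ wri σ

  -- lossy semantics of a single action
  Step : Action → Word → Word → Set
  Step (! w) x y = y ⊑ (x ++ w)
  Step (¿ w) x y = (w ++ y) ⊑ x

  data Steps : List Action → Word → Word → Set where
    done : ∀ {x} → Steps [] x x
    step : ∀ {a σ x y z} → Step a x y → Steps σ y z → Steps (a ∷ σ) x z

  pow : {A : Set} → List A → ℕ → List A
  pow w k = concat (replicate k w)

  StepsStar : List Action → Word → Word → Set
  StepsStar σ x y = ∃ λ m → Steps (pow σ m) x y

  Increasing : List Action → Set
  Increasing σ =
    0 < Data.List.length (wri σ) ×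
    (pow (rea σ) (Data.List.length (wri σ)) ⊑ pow (wri σ) (Data.List.length (wri σ) ∸ 1))

  InI : List Action → Word → Set
  InI σ z = ∀ k → ∃ λ t → Steps (pow σ k) z t

  -- pr[σ^ω](ε) = y  (i.e. I_σ = ↑y); pr[σ^ω](ε) = ⊥ iff no such y exists
  PrIs : List Action → Word → Set
  PrIs σ y = ∀ z → (InI σ z → y ⊑ z) × (y ⊑ z → InI σ z)

module Submission where

-- The greatest word reachable from x by σ^m is obtained by performing all writes first: it is the
-- residual of the leftmost embedding of u^m into x v^m, where u = rea σ and v = wri σ.  If these
-- greatest runs grow unboundedly, then after |x| + 1 rounds the channel lies inside a power of v, and
-- a much longer later run forces u^(1+N) ⊑ v^N for some N.  The residues of u^j in v^j of length
-- below ℓ = |v| are suffixes of v, so among j = 0, …, ℓ either one is long, which splices into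
-- u^ℓ ⊑ v^(ℓ-1), or two coincide, which gives a fixed point of some rounds that u^(1+N) ⊑ v^N rules
-- out.  Conversely, for increasing σ every ℓ rounds append a copy of v.  Finally the minimal
-- predecessors of ε under σ^k form an ascending chain of subwords of any x ∈ I_σ; it stalls, and its
-- limit is pr[σ^ω](ε).

open import Defs
open import Data.Nat
  using (ℕ; zero; suc; _+_; _*_; _∸_; _<_; _≤_; _≥_; z≤n; s≤s; s≤s⁻¹; _≤?_; NonZero; >-nonZero)
open import Data.Nat.Properties
open import Data.Fin using (Fin; toℕ; fromℕ<) renaming (_≟_ to _≟ᶠ_)
import Data.Fin.Properties as Fin
open import Data.List using (List; []; _∷_; _++_; length; drop)
open import Data.List.Properties using (++-assoc; length-++; ++-identityʳ; drop-all)
open import Data.List.Relation.Binary.Equality.Propositional using (≋⇒≡)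
open import Data.List.Relation.Binary.Sublist.Propositional
  using ([]; _∷_; _∷ʳ_; ⊆-refl; ⊆-trans; ⊆-antisym; minimum; ⊆-preorder)
open import Data.List.Relation.Binary.Sublist.Propositional.Properties
  using (++⁺; ++⁺ˡ; ∷ˡ⁻; length-mono-≤; to-≋)
import Data.List.Relation.Binary.Sublist.DecPropositional as DecSublist
open import Data.Maybe using (Maybe; just; nothing; _>>=_)
open import Data.Maybe.Properties using (just-injective)
open import Data.Product using (∃; ∃₂; _×_; _,_; proj₁; proj₂)
open import Data.Sum using (_⊎_; inj₁; inj₂; map₁)
open import Function using (_∘_)
open import Relation.Nullary using (Dec; yes; no; contradiction)
open import Relation.Binary.PropositionalEquality
import Relation.Binary.Reasoning.Preorder as PreorderReasoning
open import Function.Bundles using (_⇔_; mk⇔)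

bounded-increments-stall : ∀ (f : ℕ → ℕ) B → (∀ k → f k ≤ B) →
  ∃ λ K → f (suc K) ≤ f K
bounded-increments-stall f B bound = search B 0 (m≤n+m B (f 0))
  where
    search : ∀ fuel k → B ≤ f k + fuel → ∃ λ K → f (suc K) ≤ f K
    search fuel k B≤ with f (suc k) ≤? f k
    ... | yes stall = k , stall
    search zero       k B≤ | no grows =
      contradiction (≤-trans (bound (suc k)) (≤-trans B≤ (≤-reflexive (+-identityʳ (f k))))) grows
    search (suc fuel) k B≤ | no grows =
      search fuel (suc k)
        (≤-trans B≤ (≤-trans (≤-reflexive (+-suc (f k) fuel)) (+-monoˡ-≤ fuel (≰⇒> grows))))

long-or-repeat : ∀ ℓ (f : ℕ → ℕ) →
  (∃ λ j → j ≤ ℓ × ℓ ≤ f j) ⊎ (∃₂ λ i d → f i ≡ f (i + suc d) × f i < ℓ)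
long-or-repeat ℓ f with Fin.any? (λ (j : Fin (suc ℓ)) → ℓ ≤? f (toℕ j))
... | yes (j , long) = inj₁ (toℕ j , s≤s⁻¹ (Fin.toℕ<n j) , long)
... | no  none       =
  let i , j , i<j , same = Fin.pigeonhole (n<1+n ℓ) squeeze
      d , i+1+d≡j = m≤n⇒∃[o]m+o≡n i<j
      i+suc-d≡j = trans (+-suc (toℕ i) d) i+1+d≡j
  in inj₂ (toℕ i , d , trans (same-value same) (cong f (sym i+suc-d≡j)) , short i)
  where
    short : ∀ (j : Fin (suc ℓ)) → f (toℕ j) < ℓ
    short j = ≰⇒> (λ long → none (j , long))
    squeeze : Fin (suc ℓ) → Fin ℓ
    squeeze j = fromℕ< (short j)
    same-value : ∀ {i j} → squeeze i ≡ squeeze j → f (toℕ i) ≡ f (toℕ j)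
    same-value {i} {j} same =
      trans (sym (Fin.toℕ-fromℕ< (short i))) (trans (cong toℕ same) (Fin.toℕ-fromℕ< (short j)))

module _ {A : Set} where

  drop-++ : ∀ (p : List A) k v → drop (length p + k) (p ++ v) ≡ drop k v
  drop-++ []      k v = refl
  drop-++ (x ∷ p) k v = drop-++ p k v

  suffix-≡-drop : ∀ (q p : List A) {e v} → q ++ e ≡ p ++ v → length e ≤ length v →
    e ≡ drop (length v ∸ length e) v
  suffix-≡-drop q p {e} {v} eq e≤v = begin
    e                                                 ≡⟨ drop-++ q 0 e ⟨
    drop (length q + 0) (q ++ e)                      ≡⟨ cong₂ drop prefix-length eq ⟩
    drop (length p + (length v ∸ length e)) (p ++ v)  ≡⟨ drop-++ p _ v ⟩
    drop (length v ∸ length e) v                      ∎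
    where
      open ≡-Reasoning
      prefix-length : length q + 0 ≡ length p + (length v ∸ length e)
      prefix-length = begin
        length q + 0                     ≡⟨ +-identityʳ (length q) ⟩
        length q                         ≡⟨ m+n∸n≡m (length q) (length e) ⟨
        length q + length e ∸ length e   ≡⟨ cong (_∸ length e) (length-++ q) ⟨
        length (q ++ e) ∸ length e       ≡⟨ cong (λ l → length l ∸ length e) eq ⟩
        length (p ++ v) ∸ length e       ≡⟨ cong (_∸ length e) (length-++ p) ⟩
        length p + length v ∸ length e   ≡⟨ +-∸-assoc (length p) e≤v ⟩
        length p + (length v ∸ length e) ∎

module _ {n : ℕ} where

  private
    W : Set
    W = Word {n}

    Actions : Set
    Actions = List (Action {n})

    variable
      a b c e r s t x z : W
      τ τ′ σ : Actions

  module ⊑-Reasoning = PreorderReasoning (⊆-preorder {A = Fin n})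

  ⊑-++-suffix : (a ++ b) ⊑ c → b ⊑ c
  ⊑-++-suffix {a = a} p = ⊆-trans (++⁺ˡ a ⊆-refl) p

  ⊑-length-≡ : a ⊑ b → length b ≤ length a → a ≡ b
  ⊑-length-≡ p le = ≋⇒≡ (to-≋ (≤-antisym (length-mono-≤ p) le) p)

  _⊑?_ : (a b : W) → Dec (a ⊑ b)
  _⊑?_ = DecSublist._⊆?_ _≟ᶠ_

  -- pow carries an irrelevant implicit alphabet size; _^_ fixes it.
  infixl 30 _^_
  _^_ : {A : Set} → List A → ℕ → List A
  w ^ k = pow {n} w k

  ^-+ : {A : Set} (w : List A) (i j : ℕ) → w ^ (i + j) ≡ w ^ i ++ w ^ j
  ^-+ w zero    j = refl
  ^-+ w (suc i) j = trans (cong (w ++_) (^-+ w i j)) (sym (++-assoc w (w ^ i) (w ^ j)))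

  ^-suc : {A : Set} (w : List A) (k : ℕ) → w ^ suc k ≡ w ^ k ++ w
  ^-suc w k = trans (cong (w ^_) (+-comm 1 k)) (trans (^-+ w k 1) (cong (w ^ k ++_) (++-identityʳ w)))

  ^-shift : {A : Set} (w : List A) (i j : ℕ) → w ^ i ++ w ^ suc j ≡ w ^ j ++ w ^ suc i
  ^-shift w i j = begin
    w ^ i ++ w ^ suc j  ≡⟨ ^-+ w i (suc j) ⟨
    w ^ (i + suc j)     ≡⟨ cong (w ^_) (trans (+-suc i j) (cong suc (+-comm i j))) ⟩
    w ^ suc (j + i)     ≡⟨ cong (w ^_) (+-suc j i) ⟨
    w ^ (j + suc i)     ≡⟨ ^-+ w j (suc i) ⟩
    w ^ j ++ w ^ suc i  ∎
    where open ≡-Reasoning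

  ^-* : {A : Set} (w : List A) (i j : ℕ) → w ^ (i * j) ≡ (w ^ j) ^ i
  ^-* w zero    j = refl
  ^-* w (suc i) j = trans (^-+ w j (i * j)) (cong (w ^ j ++_) (^-* w i j))

  ^-^-comm : {A : Set} (w : List A) (i j : ℕ) → (w ^ i) ^ j ≡ (w ^ j) ^ i
  ^-^-comm w i j = trans (sym (^-* w j i)) (trans (cong (w ^_) (*-comm j i)) (^-* w i j))

  length-^ : {A : Set} (w : List A) (k : ℕ) → length (w ^ k) ≡ k * length w
  length-^ w zero    = refl
  length-^ w (suc k) = trans (length-++ w) (cong (length w +_) (length-^ w k))

  ^⁺ : ∀ k → a ⊑ b → a ^ k ⊑ b ^ k
  ^⁺ zero    p = ⊆-refl
  ^⁺ (suc k) p = ++⁺ p (^⁺ k p)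

  ^-⊑-short : ∀ (u a : W) → u ^ suc (length a) ⊑ a → u ≡ []
  ^-⊑-short []      a _ = refl
  ^-⊑-short (x ∷ u) a p = contradiction (length-mono-≤ p) (<⇒≱ (begin-strict
    length a                              <⟨ n<1+n (length a) ⟩
    suc (length a)                        ≤⟨ m≤m*n (suc (length a)) (suc (length u)) ⟩
    suc (length a) * length (x ∷ u)       ≡⟨ length-^ (x ∷ u) (suc (length a)) ⟨
    length ((x ∷ u) ^ suc (length a))     ∎))
    where open ≤-Reasoning

  rea-++ : (τ τ′ : Actions) → rea (τ ++ τ′) ≡ rea τ ++ rea τ′
  rea-++ []      τ′ = refl
  rea-++ (α ∷ τ) τ′ =
    trans (cong (rea₁ α ++_) (rea-++ τ τ′)) (sym (++-assoc (rea₁ α) (rea τ) (rea τ′)))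

  wri-++ : (τ τ′ : Actions) → wri (τ ++ τ′) ≡ wri τ ++ wri τ′
  wri-++ []      τ′ = refl
  wri-++ (α ∷ τ) τ′ =
    trans (cong (wri₁ α ++_) (wri-++ τ τ′)) (sym (++-assoc (wri₁ α) (wri τ) (wri τ′)))

  rea-^ : (σ : Actions) (k : ℕ) → rea (σ ^ k) ≡ rea σ ^ k
  rea-^ σ zero    = refl
  rea-^ σ (suc k) = trans (rea-++ σ (σ ^ k)) (cong (rea σ ++_) (rea-^ σ k))

  wri-^ : (σ : Actions) (k : ℕ) → wri (σ ^ k) ≡ wri σ ^ k
  wri-^ σ zero    = refl
  wri-^ σ (suc k) = trans (wri-++ σ (σ ^ k)) (cong (wri σ ++_) (wri-^ σ k))

  -- Greedy embeddings

  residual : W → W → Maybe W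
  residual []      s       = just s
  residual (x ∷ w) []      = nothing
  residual (x ∷ w) (y ∷ s) with x ≟ᶠ y
  ... | yes _ = residual w s
  ... | no  _ = residual (x ∷ w) s

  residual-sound : ∀ w s → residual w s ≡ just r → (w ++ r) ⊑ s
  residual-sound []      s       refl = ⊆-refl
  residual-sound (x ∷ w) (y ∷ s) eq with x ≟ᶠ y
  ... | yes refl = refl ∷ residual-sound w s eq
  ... | no  _    = y ∷ʳ residual-sound (x ∷ w) s eq

  residual-complete : ∀ w s → (w ++ r) ⊑ s → ∃ λ r′ → residual w s ≡ just r′ × r ⊑ r′
  residual-complete []      s       p = s , refl , p
  residual-complete (x ∷ w) (y ∷ s) p with x ≟ᶠ y
  residual-complete (x ∷ w) (y ∷ s) (.y ∷ʳ p) | yes refl = residual-complete w s (∷ˡ⁻ p)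
  residual-complete (x ∷ w) (y ∷ s) (refl ∷ p) | yes refl = residual-complete w s p
  residual-complete (x ∷ w) (y ∷ s) (.y ∷ʳ p) | no _     = residual-complete (x ∷ w) s p
  residual-complete (x ∷ w) (y ∷ s) (refl ∷ p) | no x≢y  = contradiction refl x≢y

  residual-defined : ∀ w s → w ⊑ s → ∃ λ r → residual w s ≡ just r
  residual-defined w s p =
    let r , eq , _ = residual-complete w s (subst (_⊑ s) (sym (++-identityʳ w)) p) in r , eq

  residual-mono : ∀ w → s ⊑ t → residual w s ≡ just r →
    ∃ λ r′ → residual w t ≡ just r′ × r ⊑ r′
  residual-mono {s = s} {t = t} w s⊑t eq = residual-complete w t (⊆-trans (residual-sound w s eq) s⊑t)

  residual-suffix : ∀ w s → residual w s ≡ just r → ∃ λ q → q ++ r ≡ s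
  residual-suffix []      s       refl = [] , refl
  residual-suffix (x ∷ w) (y ∷ s) eq with x ≟ᶠ y
  ... | yes _ = let q , e = residual-suffix w s eq in y ∷ q , cong (y ∷_) e
  ... | no  _ = let q , e = residual-suffix (x ∷ w) s eq in y ∷ q , cong (y ∷_) e

  residual-++ʳ : ∀ w s t → residual w s ≡ just r → residual w (s ++ t) ≡ just (r ++ t)
  residual-++ʳ []      s       t refl = refl
  residual-++ʳ (x ∷ w) (y ∷ s) t eq with x ≟ᶠ y
  ... | yes _ = residual-++ʳ w s t eq
  ... | no  _ = residual-++ʳ (x ∷ w) s t eq

  residual-++ˡ : ∀ w w′ s → residual (w ++ w′) s ≡ (residual w s >>= residual w′)
  residual-++ˡ []      w′ s       = refl
  residual-++ˡ (x ∷ w) w′ []      = refl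
  residual-++ˡ (x ∷ w) w′ (y ∷ s) with x ≟ᶠ y
  ... | yes _ = residual-++ˡ w w′ s
  ... | no  _ = residual-++ˡ (x ∷ w) w′ s

  residual-shrinks : ∀ x w s → residual (x ∷ w) s ≡ just r → length r < length s
  residual-shrinks {r = r} x w s eq = begin-strict
    length r              ≤⟨ m≤n+m (length r) (length w) ⟩
    length w + length r   ≡⟨ length-++ w ⟨
    length (w ++ r)       <⟨ length-mono-≤ (residual-sound (x ∷ w) s eq) ⟩
    length s              ∎
    where open ≤-Reasoning

  residual-++-split : ∀ w a b → residual w (a ++ b) ≡ just e →
    w ⊑ a ⊎ (e ⊑ b × length e < length b)
  residual-++-split []      a       b eq = inj₁ (minimum a)
  residual-++-split (x ∷ w) []      b eq =
    inj₂ (⊑-++-suffix {a = x ∷ w} (residual-sound (x ∷ w) b eq) , residual-shrinks x w b eq)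
  residual-++-split (x ∷ w) (y ∷ a) b eq with x ≟ᶠ y
  ... | yes refl = map₁ (refl ∷_) (residual-++-split w a b eq)
  ... | no  _    = map₁ (y ∷ʳ_) (residual-++-split (x ∷ w) a b eq)

  rounds : W → W → ℕ → W → Maybe W
  rounds u v m s = residual (u ^ m) (s ++ v ^ m)

  rounds-+ : ∀ u v i j → rounds u v i s ≡ just r → rounds u v (i + j) s ≡ rounds u v j r
  rounds-+ {s = s} {r = r} u v i j eq = begin
    residual (u ^ (i + j)) (s ++ v ^ (i + j))
      ≡⟨ cong₂ (λ p q → residual p (s ++ q)) (^-+ u i j) (^-+ v i j) ⟩
    residual (u ^ i ++ u ^ j) (s ++ v ^ i ++ v ^ j)
      ≡⟨ cong (residual (u ^ i ++ u ^ j)) (sym (++-assoc s (v ^ i) (v ^ j))) ⟩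
    residual (u ^ i ++ u ^ j) ((s ++ v ^ i) ++ v ^ j)
      ≡⟨ residual-++ˡ (u ^ i) (u ^ j) _ ⟩
    (residual (u ^ i) ((s ++ v ^ i) ++ v ^ j) >>= residual (u ^ j))
      ≡⟨ cong (_>>= residual (u ^ j)) (residual-++ʳ (u ^ i) (s ++ v ^ i) (v ^ j) eq) ⟩
    residual (u ^ j) (r ++ v ^ j) ∎
    where open ≡-Reasoning

  rounds-fixpoint : ∀ u v d → rounds u v d s ≡ just s → ∀ k → rounds u v (k * d) s ≡ just s
  rounds-fixpoint {s = s} u v d fix zero    = cong just (++-identityʳ s)
  rounds-fixpoint         u v d fix (suc k) = trans (rounds-+ u v d (k * d) fix) (rounds-fixpoint u v d fix k)

  -- Shortening a lag u^(1+N) ⊑ v^N to N = |v| - 1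

  ^-cancel-⊑ : ∀ {u v : W} k → u ^ suc k ⊑ v ^ suc k → u ⊑ v
  ^-cancel-⊑ {u} {v} zero p = subst₂ _⊑_ (++-identityʳ u) (++-identityʳ v) p
  ^-cancel-⊑ {u} {v} (suc k) p
    with e , eq , u^k⊑e ← residual-complete u (v ++ v ^ suc k) p
    with residual-++-split u v (v ^ suc k) eq
  ... | inj₁ u⊑v          = u⊑v
  ... | inj₂ (e⊑v^k , _)  = ^-cancel-⊑ k (⊆-trans u^k⊑e e⊑v^k)

  module PowerEmbedding (u v : W) (N : ℕ) (lag : u ^ suc N ⊑ v ^ N) where

    private
      ℓ : ℕ
      ℓ = length v

    u^j⊑v^j : ∀ j → u ^ j ⊑ v ^ j
    u^j⊑v^j j = ^-cancel-⊑ N (subst₂ _⊑_ (^-^-comm u (suc N) j) (^-^-comm v (suc N) j)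
                                (^⁺ j (⊆-trans lag (++⁺ˡ v ⊆-refl))))

    residue : ℕ → W
    residue j = proj₁ (residual-defined (u ^ j) (v ^ j) (u^j⊑v^j j))

    rounds-residue : ∀ j → rounds u v j [] ≡ just (residue j)
    rounds-residue j = proj₂ (residual-defined (u ^ j) (v ^ j) (u^j⊑v^j j))

    residue-+ : ∀ i d → rounds u v d (residue i) ≡ just (residue (i + d))
    residue-+ i d = trans (sym (rounds-+ u v i d (rounds-residue i))) (rounds-residue (i + d))

    residue-zero : residue 0 ≡ []
    residue-zero = just-injective (sym (rounds-residue 0))

    residue-suffix : ∀ j → length (residue j) ≤ ℓ →
      residue j ≡ drop (ℓ ∸ length (residue j)) v
    residue-suffix zero _ rewrite residue-zero = sym (drop-all ℓ v ≤-refl)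
    residue-suffix (suc j) short =
      let q , eq = residual-suffix (u ^ suc j) (v ^ suc j) (rounds-residue (suc j))
      in suffix-≡-drop q (v ^ j) (trans eq (^-suc v j)) short

    long-residue : ∀ j → j ≤ ℓ → ℓ ≤ length (residue j) → u ^ ℓ ⊑ v ^ (ℓ ∸ 1)
    long-residue zero _ long rewrite residue-zero | n≤0⇒n≡0 long = minimum _
    long-residue (suc j) j<ℓ long
      with residual-++-split (u ^ suc j) (v ^ j) v
             (subst (λ s → residual (u ^ suc j) s ≡ just (residue (suc j)))
                    (^-suc v j) (rounds-residue (suc j)))
    ... | inj₂ (_ , short) = contradiction long (<⇒≱ short)
    ... | inj₁ u^1+j⊑v^j  =
      subst₂ _⊑_ (trans (sym (^-+ u (suc j) (ℓ ∸ suc j))) (cong (u ^_) (m+[n∸m]≡n j<ℓ)))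
                 (trans (sym (^-+ v j (ℓ ∸ suc j))) (cong (λ m → v ^ (m ∸ 1)) (m+[n∸m]≡n j<ℓ)))
                 (++⁺ u^1+j⊑v^j (u^j⊑v^j (ℓ ∸ suc j)))

    rounds-defined : ∀ m s → ∃ λ e → rounds u v m s ≡ just e
    rounds-defined m s = residual-defined (u ^ m) (s ++ v ^ m) (++⁺ˡ s (u^j⊑v^j m))

    rounds-lengthens : ∀ s → ∃ λ e → rounds u v (suc N) s ≡ just e × ℓ ≤ length e
    rounds-lengthens s =
      let e , eq , v⊑e = residual-complete (u ^ suc N) (s ++ v ^ suc N)
                           (++⁺ˡ s (subst ((u ^ suc N ++ v) ⊑_) (sym (^-suc v N)) (++⁺ lag ⊆-refl)))
      in e , eq , length-mono-≤ v⊑e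

    -- (1+N)(1+d) rounds lead back to s, but their last 1+N rounds always leave a word of length ≥ ℓ.
    no-short-fixpoint : ∀ d → rounds u v (suc d) s ≡ just s → ℓ ≤ length s
    no-short-fixpoint {s = s} d fix =
      let e₁ , eq₁       = rounds-defined M s
          e , eq , long  = rounds-lengthens e₁
      in subst (λ t → ℓ ≤ length t) (just-injective (begin
           just e                         ≡⟨ eq ⟨
           rounds u v (suc N) e₁          ≡⟨ rounds-+ u v M (suc N) eq₁ ⟨
           rounds u v (M + suc N) s       ≡⟨ cong (λ m → rounds u v m s) M+1+N ⟩
           rounds u v (suc N * suc d) s   ≡⟨ rounds-fixpoint u v (suc d) fix (suc N) ⟩
           just s                         ∎)) long
      where
        open ≡-Reasoning
        M : ℕ
        M = suc N * suc d ∸ suc N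
        M+1+N : M + suc N ≡ suc N * suc d
        M+1+N = m∸n+n≡m (m≤m*n (suc N) (suc d))

    power-embedding-at-length : u ^ ℓ ⊑ v ^ (ℓ ∸ 1)
    power-embedding-at-length with long-or-repeat ℓ (length ∘ residue)
    ... | inj₁ (j , j≤ℓ , long)          = long-residue j j≤ℓ long
    ... | inj₂ (i , d , same-length , short) =
      contradiction (no-short-fixpoint d (trans (residue-+ i (suc d)) (cong just periodic))) (<⇒≱ short)
      where
        periodic : residue (i + suc d) ≡ residue i
        periodic = begin
          residue (i + suc d)
            ≡⟨ residue-suffix (i + suc d) (subst (_≤ ℓ) same-length (<⇒≤ short)) ⟩
          drop (ℓ ∸ length (residue (i + suc d))) v
            ≡⟨ cong (λ m → drop (ℓ ∸ m) v) same-length ⟨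
          drop (ℓ ∸ length (residue i)) v
            ≡⟨ residue-suffix i (<⇒≤ short) ⟨
          residue i
            ∎
          where open ≡-Reasoning

  -- Lossy runs

  Step-mono : ∀ α → a ⊑ b → Step α a t → Step α b t
  Step-mono (! w) a⊑b st = ⊆-trans st (++⁺ a⊑b ⊆-refl)
  Step-mono (¿ w) a⊑b st = ⊆-trans st a⊑b

  Steps-mono : a ⊑ b → Steps τ a t → ∃ λ t′ → Steps τ b t′ × t ⊑ t′
  Steps-mono {b = b} a⊑b done             = b , done , a⊑b
  Steps-mono         a⊑b (step {α} st sts) = _ , step (Step-mono α a⊑b st) sts , ⊆-refl

  Steps-++ : Steps τ a b → Steps τ′ b c → Steps (τ ++ τ′) a c
  Steps-++ done        sts′ = sts′
  Steps-++ (step st sts) sts′ = step st (Steps-++ sts sts′)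

  Steps-split : ∀ τ → Steps (τ ++ τ′) a c → ∃ λ b → Steps τ a b × Steps τ′ b c
  Steps-split []      sts           = _ , done , sts
  Steps-split (α ∷ τ) (step st sts) =
    let b , sts₁ , sts₂ = Steps-split τ sts in b , step st sts₁ , sts₂

  Steps-length : Steps τ a t → length t ≤ length a + length (wri τ)
  Steps-length {a = a} done = m≤m+n (length a) 0
  Steps-length {τ = ! w ∷ τ} {a = a} {t = t} (step {y = b} st sts) = begin
    length t                               ≤⟨ Steps-length sts ⟩
    length b + length (wri τ)              ≤⟨ +-monoˡ-≤ (length (wri τ)) (length-mono-≤ st) ⟩
    length (a ++ w) + length (wri τ)       ≡⟨ cong (_+ length (wri τ)) (length-++ a) ⟩
    length a + length w + length (wri τ)   ≡⟨ +-assoc (length a) (length w) (length (wri τ)) ⟩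
    length a + (length w + length (wri τ)) ≡⟨ cong (length a +_) (length-++ w) ⟨
    length a + length (w ++ wri τ)         ∎
    where open ≤-Reasoning
  Steps-length {τ = ¿ w ∷ τ} (step st sts) =
    ≤-trans (Steps-length sts) (+-monoˡ-≤ (length (wri τ)) (length-mono-≤ (⊑-++-suffix {a = w} st)))

  greatest-run : ∀ τ → Steps τ a t →
    ∃ λ D → residual (rea τ) (a ++ wri τ) ≡ just D × Steps τ a D × t ⊑ D
  greatest-run {a = a} [] done = a , cong just (++-identityʳ a) , done , ⊆-refl
  greatest-run {a = a} (! w ∷ τ) (step st sts) =
    let t′ , sts′ , t⊑t′ = Steps-mono st sts
        D , eq , run , t′⊑D = greatest-run τ sts′
    in D
     , trans (cong (residual (rea τ)) (sym (++-assoc a w (wri τ)))) eq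
     , step ⊆-refl run
     , ⊆-trans t⊑t′ t′⊑D
  greatest-run {a = a} (¿ w ∷ τ) (step st sts) =
    let b , eq₁ , b⊑ = residual-complete w a st
        t′ , sts′ , t⊑t′ = Steps-mono b⊑ sts
        D , eq , run , t′⊑D = greatest-run τ sts′
    in D
     , trans (residual-++ˡ w (rea τ) (a ++ wri τ))
             (trans (cong (_>>= residual (rea τ)) (residual-++ʳ w a (wri τ) eq₁)) eq)
     , step (residual-sound w a eq₁) run
     , ⊆-trans t⊑t′ t′⊑D

  Steps-^-++ : ∀ σ i j → Steps (σ ^ i) a b → Steps (σ ^ j) b c → Steps (σ ^ (i + j)) a c
  Steps-^-++ {a = a} {c = c} σ i j a→b b→c =
    subst (λ τ → Steps τ a c) (sym (^-+ σ i j)) (Steps-++ a→b b→c)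

  Steps-^-split : ∀ σ i j → Steps (σ ^ (i + j)) a c →
    ∃ λ b → Steps (σ ^ i) a b × Steps (σ ^ j) b c
  Steps-^-split {a = a} {c = c} σ i j a→c =
    Steps-split (σ ^ i) (subst (λ τ → Steps τ a c) (^-+ σ i j) a→c)

  StepsStar-trans : ∀ σ → StepsStar σ a b → StepsStar σ b c → StepsStar σ a c
  StepsStar-trans σ (i , a→b) (j , b→c) = i + j , Steps-^-++ σ i j a→b b→c

  Steps-^-length : ∀ σ m → Steps (σ ^ m) a t → length t ≤ length a + m * length (wri σ)
  Steps-^-length {a = a} σ m sts = ≤-trans (Steps-length sts)
    (≤-reflexive (cong (length a +_) (trans (cong length (wri-^ σ m)) (length-^ (wri σ) m))))

  Steps-^-longer : ∀ σ k m → Steps (σ ^ m) a t → length a + k * length (wri σ) < length t →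
    ∃ λ j → m ≡ k + suc j
  Steps-^-longer {a = a} σ k m run longer =
    let k<m = *-cancelʳ-< (length (wri σ)) k m
                (+-cancelˡ-< (length a) _ _ (<-≤-trans longer (Steps-^-length σ m run)))
        j , k+1+j≡m = m≤n⇒∃[o]m+o≡n k<m
    in j , sym (trans (+-suc k j) k+1+j≡m)

  greatest-run-^ : ∀ σ m → Steps (σ ^ m) a t →
    ∃ λ D → rounds (rea σ) (wri σ) m a ≡ just D × Steps (σ ^ m) a D × t ⊑ D
  greatest-run-^ {a = a} σ m sts =
    let D , eq , run , t⊑D = greatest-run (σ ^ m) sts
    in D , trans (cong₂ (λ p q → residual p (a ++ q)) (sym (rea-^ σ m)) (sym (wri-^ σ m))) eq
         , run , t⊑D

  -- Minimal predecessors

  preWrite : W → W → W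
  preWrite w []      = []
  preWrite w (x ∷ b) with (x ∷ b) ⊑? w
  ... | yes _ = []
  ... | no  _ = x ∷ preWrite w b

  preWrite-sound : ∀ w b → b ⊑ (preWrite w b ++ w)
  preWrite-sound w []      = minimum _
  preWrite-sound w (x ∷ b) with (x ∷ b) ⊑? w
  ... | yes x∷b⊑w = x∷b⊑w
  ... | no  _     = refl ∷ preWrite-sound w b

  preWrite-least : ∀ w b z → b ⊑ (z ++ w) → preWrite w b ⊑ z
  preWrite-least w []      z p = minimum z
  preWrite-least w (x ∷ b) z p with (x ∷ b) ⊑? w
  ... | yes _     = minimum z
  ... | no  x∷b⋢w = matched z p
    where
      matched : ∀ z → (x ∷ b) ⊑ (z ++ w) → (x ∷ preWrite w b) ⊑ z
      matched []      p          = contradiction p x∷b⋢w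
      matched (y ∷ z) (.y ∷ʳ p)  = y ∷ʳ matched z p
      matched (y ∷ z) (refl ∷ p) = refl ∷ preWrite-least w b z p

  -- Pre[!w](↑b) = ↑(preWrite w b) and Pre[τ](↑a) = ↑(minPre τ a).
  minPre : Actions → W → W
  minPre []        a = a
  minPre (! w ∷ τ) a = preWrite w (minPre τ a)
  minPre (¿ w ∷ τ) a = w ++ minPre τ a

  minPre-run : ∀ τ a → minPre τ a ⊑ z → ∃ λ t → Steps τ z t × a ⊑ t
  minPre-run [] a p = _ , done , p
  minPre-run (! w ∷ τ) a p =
    let t , sts , a⊑t = minPre-run τ a ⊆-refl
    in t , step (⊆-trans (preWrite-sound w (minPre τ a)) (++⁺ p ⊆-refl)) sts , a⊑t
  minPre-run (¿ w ∷ τ) a p =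
    let t , sts , a⊑t = minPre-run τ a ⊆-refl
    in t , step p sts , a⊑t

  minPre-least : ∀ τ a → Steps τ z t → a ⊑ t → minPre τ a ⊑ z
  minPre-least []        a done          a⊑t = a⊑t
  minPre-least (! w ∷ τ) a (step st sts) a⊑t =
    preWrite-least w (minPre τ a) _ (⊆-trans (minPre-least τ a sts a⊑t) st)
  minPre-least (¿ w ∷ τ) a (step st sts) a⊑t =
    ⊆-trans (++⁺ (⊆-refl {x = w}) (minPre-least τ a sts a⊑t)) st

  minPre-++ : ∀ τ τ′ a → minPre (τ ++ τ′) a ≡ minPre τ (minPre τ′ a)
  minPre-++ []        τ′ a = refl
  minPre-++ (! w ∷ τ) τ′ a = cong (preWrite w) (minPre-++ τ τ′ a)
  minPre-++ (¿ w ∷ τ) τ′ a = cong (w ++_) (minPre-++ τ τ′ a)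

  minPre-mono : ∀ τ → a ⊑ b → minPre τ a ⊑ minPre τ b
  minPre-mono {a = a} {b = b} τ a⊑b =
    let t , sts , b⊑t = minPre-run τ b ⊆-refl in minPre-least τ a sts (⊆-trans a⊑b b⊑t)

  module _ (σ : Actions) where

    basis : ℕ → W
    basis k = minPre (σ ^ k) []

    basis-suc : ∀ k → basis (suc k) ≡ minPre σ (basis k)
    basis-suc k = minPre-++ σ (σ ^ k) []

    basis-⊑-suc : ∀ k → basis k ⊑ basis (suc k)
    basis-⊑-suc zero    = minimum _
    basis-⊑-suc (suc k) =
      subst₂ _⊑_ (sym (basis-suc k)) (sym (basis-suc (suc k))) (minPre-mono σ (basis-⊑-suc k))

    basis-⊑-+ : ∀ j k → basis k ⊑ basis (j + k)
    basis-⊑-+ zero    k = ⊆-refl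
    basis-⊑-+ (suc j) k = ⊆-trans (basis-⊑-+ j k) (basis-⊑-suc (j + k))

    basis-stable : ∀ K → basis K ≡ basis (suc K) → ∀ j → basis (j + K) ≡ basis K
    basis-stable K fix zero    = refl
    basis-stable K fix (suc j) = begin
      basis (suc j + K)          ≡⟨ basis-suc (j + K) ⟩
      minPre σ (basis (j + K))   ≡⟨ cong (minPre σ) (basis-stable K fix j) ⟩
      minPre σ (basis K)         ≡⟨ basis-suc K ⟨
      basis (suc K)              ≡⟨ fix ⟨
      basis K                    ∎
      where open ≡-Reasoning

    InI⇒basis-⊑ : InI σ z → ∀ k → basis k ⊑ z
    InI⇒basis-⊑ hz k = let t , sts = hz k in minPre-least (σ ^ k) [] sts (minimum t)

    basis-⊑⇒InI : (∀ k → basis k ⊑ z) → InI σ z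
    basis-⊑⇒InI below k = let t , sts , _ = minPre-run (σ ^ k) [] (below k) in t , sts

    basis-⊑-stalled : ∀ K → length (basis (suc K)) ≤ length (basis K) →
      ∀ k → basis k ⊑ basis K
    basis-⊑-stalled K stall k = subst (basis k ⊑_) K+k≡K (basis-⊑-+ K k)
      where
        K+k≡K : basis (K + k) ≡ basis K
        K+k≡K = trans (cong basis (+-comm K k)) (basis-stable K (⊑-length-≡ (basis-⊑-suc K) stall) k)

    stalled-basis-pr : ∀ K → length (basis (suc K)) ≤ length (basis K) → PrIs σ (basis K)
    stalled-basis-pr K stall z =
      (λ hz → InI⇒basis-⊑ hz K) ,
      (λ K⊑z → basis-⊑⇒InI λ k → ⊆-trans (basis-⊑-stalled K stall k) K⊑z)

    InI⇒pr : InI σ a → ∃ λ y → PrIs σ y × y ⊑ a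
    InI⇒pr {a = a} ha
      with K , stall ← bounded-increments-stall (length ∘ basis) (length a)
                         (length-mono-≤ ∘ InI⇒basis-⊑ ha)
      = basis K , stalled-basis-pr K stall , InI⇒basis-⊑ ha K

  UnboundedReach : W → Actions → Set
  UnboundedReach x σ = ∀ k → ∃ λ xk → StepsStar σ x xk × length xk ≥ k

  GrowingChain : W → Actions → Set
  GrowingChain x σ = ∃ λ (f : ℕ → W) → StepsStar σ x (f 0) ×
    (∀ i → StepsStar σ (f i) (f (suc i))) × (∀ i → length (f i) < length (f (suc i)))

  chain⇒unbounded : GrowingChain x σ → UnboundedReach x σ
  chain⇒unbounded {x = x} {σ = σ} (f , x→f₀ , f→f , grows) k = f k , reach k , long k
    where
      reach : ∀ i → StepsStar σ x (f i)
      reach zero    = x→f₀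
      reach (suc i) = StepsStar-trans σ (reach i) (f→f i)
      long : ∀ i → i ≤ length (f i)
      long zero    = z≤n
      long (suc i) = ≤-<-trans (long i) (grows i)

  unbounded⇒InI : UnboundedReach x σ → InI σ x
  unbounded⇒InI {x = x} {σ = σ} U k
    with xk , (m , run) , longer ← U (suc (length x + k * length (wri σ)))
    with j , refl ← Steps-^-longer σ k m run longer
    = let b , x→b , _ = Steps-^-split σ k (suc j) run in b , x→b

  unbounded⇒wri-nonempty : UnboundedReach x σ → 0 < length (wri σ)
  unbounded⇒wri-nonempty {x = x} {σ = σ} U
    with xk , (m , run) , longer ← U (suc (length x))
    with length (wri σ) | Steps-^-length σ m run
  ... | suc _ | _ = s≤s z≤n
  ... | zero  | bounded rewrite *-zeroʳ m | +-identityʳ (length x) =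
    contradiction (≤-trans longer bounded) (n≮n (length x))

  module MaximalRuns {x : W} {σ : Actions} (hx : InI σ x) where

    private
      u v : W
      u = rea σ
      v = wri σ
      ℓ : ℕ
      ℓ = length v

    maxRun : ℕ → W
    maxRun m = proj₁ (greatest-run-^ σ m (proj₂ (hx m)))

    maxRun-rounds : ∀ m → rounds u v m x ≡ just (maxRun m)
    maxRun-rounds m = proj₁ (proj₂ (greatest-run-^ σ m (proj₂ (hx m))))

    maxRun-run : ∀ m → Steps (σ ^ m) x (maxRun m)
    maxRun-run m = proj₁ (proj₂ (proj₂ (greatest-run-^ σ m (proj₂ (hx m)))))

    maxRun-greatest : ∀ m → Steps (σ ^ m) x t → t ⊑ maxRun m
    maxRun-greatest {t = t} m run =
      let D , eq , _ , t⊑D = greatest-run-^ σ m run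
      in subst (t ⊑_) (just-injective (trans (sym eq) (maxRun-rounds m))) t⊑D

    maxRun-length : ∀ m → length (maxRun m) ≤ length x + m * ℓ
    maxRun-length m = Steps-^-length σ m (maxRun-run m)

    maxRun-+ : ∀ m j → rounds u v j (maxRun m) ≡ just (maxRun (m + j))
    maxRun-+ m j = trans (sym (rounds-+ u v m j (maxRun-rounds m))) (maxRun-rounds (m + j))

    maxRun-reach : ∀ m j → StepsStar σ (maxRun m) (maxRun (m + j))
    maxRun-reach m j =
      let b , x→b , b→end = Steps-^-split σ m j (maxRun-run (m + j))
          t , D→t , end⊑t = Steps-mono (maxRun-greatest m x→b) b→end
          t⊑end = maxRun-greatest (m + j) (Steps-^-++ σ m j (maxRun-run m) D→t)
      in j , subst (Steps (σ ^ j) (maxRun m)) (⊆-antisym t⊑end end⊑t) D→t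

    maxRun-⊒ : ∀ m j → (u ^ j ++ r) ⊑ (maxRun m ++ v ^ j) → r ⊑ maxRun (m + j)
    maxRun-⊒ {r = r} m j fits =
      let E , eq , r⊑E = residual-complete (u ^ j) (maxRun m ++ v ^ j) fits
      in subst (r ⊑_) (just-injective (trans (sym eq) (maxRun-+ m j))) r⊑E

    maxRun-unbounded : UnboundedReach x σ → ∀ K → ∃ λ m → K ≤ length (maxRun m)
    maxRun-unbounded U K =
      let xk , (m , run) , long = U K in m , ≤-trans long (length-mono-≤ (maxRun-greatest m run))

    later-if-longer : ∀ k m → length x + k * ℓ < length (maxRun m) → ∃ λ j → m ≡ k + suc j
    later-if-longer k m = Steps-^-longer σ k m (maxRun-run m)

    unbounded⇒chain : UnboundedReach x σ → GrowingChain x σ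
    unbounded⇒chain U = maxRun ∘ g , (0 , maxRun-run 0) , reach , grows
      where
        g : ℕ → ℕ
        g zero    = 0
        g (suc i) = proj₁ (maxRun-unbounded U (suc (length x + g i * ℓ)))
        g-longer : ∀ i → length x + g i * ℓ < length (maxRun (g (suc i)))
        g-longer i = proj₂ (maxRun-unbounded U (suc (length x + g i * ℓ)))
        grows : ∀ i → length (maxRun (g i)) < length (maxRun (g (suc i)))
        grows i = ≤-<-trans (maxRun-length (g i)) (g-longer i)
        reach : ∀ i → StepsStar σ (maxRun (g i)) (maxRun (g (suc i)))
        reach i = let j , g≡ = later-if-longer (g i) (g (suc i)) (g-longer i)
                  in subst (StepsStar σ (maxRun (g i)) ∘ maxRun) (sym g≡) (maxRun-reach (g i) (suc j))

    lag-from-long-run : ∀ m N → maxRun m ⊑ v ^ m → suc m * ℓ ≤ length (maxRun (m + suc N)) →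
      u ^ suc N ⊑ v ^ N
    lag-from-long-run m N D⊑v^m long
      with E , eq , D⊑E ← residual-mono (u ^ suc N)
                            (subst ((maxRun m ++ v ^ suc N) ⊑_) (^-shift v m N) (++⁺ D⊑v^m ⊆-refl))
                            (maxRun-+ m (suc N))
      with residual-++-split (u ^ suc N) (v ^ N) (v ^ suc m) eq
    ... | inj₁ lag         = lag
    ... | inj₂ (_ , short) = contradiction (≤-trans long (length-mono-≤ D⊑E))
                               (<⇒≱ (<-≤-trans short (≤-reflexive (length-^ v (suc m)))))

    unbounded⇒lag : UnboundedReach x σ → ∃ λ N → u ^ suc N ⊑ v ^ N
    unbounded⇒lag U
      with residual-++-split (u ^ suc (length x)) x (v ^ suc (length x)) (maxRun-rounds (suc (length x)))
    ... | inj₁ u^m⊑x = 0 , subst (λ w → w ^ 1 ⊑ v ^ 0) (sym (^-⊑-short u x u^m⊑x)) []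
    ... | inj₂ (D⊑v^m , _)
      with m′ , longer ← maxRun-unbounded U (suc (length x + suc (suc (length x)) * ℓ))
      with N , refl ← later-if-longer (suc (length x)) m′
                        (≤-<-trans (+-monoʳ-≤ (length x) (*-monoˡ-≤ ℓ (n≤1+n (suc (length x))))) longer)
      = N , lag-from-long-run (suc (length x)) N D⊑v^m (≤-trans (m≤n+m _ (length x)) (<⇒≤ longer))

    unbounded⇒increasing : UnboundedReach x σ → Increasing σ
    unbounded⇒increasing U =
      let N , lag = unbounded⇒lag U
      in unbounded⇒wri-nonempty U , PowerEmbedding.power-embedding-at-length u v N lag

    increasing⇒unbounded : Increasing σ → UnboundedReach x σ
    increasing⇒unbounded (ℓ>0 , u^ℓ⊑v^ℓ∸1) k =
      maxRun (k * ℓ) , (k * ℓ , maxRun-run (k * ℓ)) , long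
      where
        instance
          ℓ≢0 : NonZero ℓ
          ℓ≢0 = >-nonZero ℓ>0
        v^k⊑maxRun : ∀ k → v ^ k ⊑ maxRun (k * ℓ)
        v^k⊑maxRun zero    = minimum _
        v^k⊑maxRun (suc k) =
          subst (λ i → v ^ suc k ⊑ maxRun i) (+-comm (k * ℓ) ℓ) (maxRun-⊒ (k * ℓ) ℓ (begin
            u ^ ℓ ++ v ^ suc k          ≲⟨ ++⁺ u^ℓ⊑v^ℓ∸1 ⊆-refl ⟩
            v ^ (ℓ ∸ 1) ++ v ^ suc k    ≡⟨ ^-shift v (ℓ ∸ 1) k ⟩
            v ^ k ++ v ^ suc (ℓ ∸ 1)    ≡⟨ cong (λ i → v ^ k ++ v ^ i) (m+[n∸m]≡n ℓ>0) ⟩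
            v ^ k ++ v ^ ℓ              ≲⟨ ++⁺ (v^k⊑maxRun k) ⊆-refl ⟩
            maxRun (k * ℓ) ++ v ^ ℓ     ∎))
          where open ⊑-Reasoning
        long : k ≤ length (maxRun (k * ℓ))
        long = begin
          k                       ≤⟨ m≤m*n k ℓ ⟩
          k * ℓ                   ≡⟨ length-^ v k ⟨
          length (v ^ k)          ≤⟨ length-mono-≤ (v^k⊑maxRun k) ⟩
          length (maxRun (k * ℓ)) ∎
          where open ≤-Reasoning

open MaximalRuns

lemma21 : {n : ℕ} (x : Word {n}) (σ : Data.List.List (Action {n})) →
    ((∀ k → ∃ λ xk → StepsStar σ x xk × length xk ≥ k) ⇔
     (∃ λ (f : ℕ → Word {n}) → StepsStar σ x (f 0) ×
        (∀ i → StepsStar σ (f i) (f (suc i))) ×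
        (∀ i → length (f i) < length (f (suc i)))))
    ×
    ((∃ λ (f : ℕ → Word {n}) → StepsStar σ x (f 0) ×
        (∀ i → StepsStar σ (f i) (f (suc i))) ×
        (∀ i → length (f i) < length (f (suc i))))
      ⇔ (Increasing σ × ∃ λ y → PrIs σ y × y ⊑ x))
lemma21 x σ = mk⇔ i⇒ii chain⇒unbounded , mk⇔ (i⇒iii ∘ chain⇒unbounded) iii⇒ii
  where
    i⇒ii : UnboundedReach x σ → GrowingChain x σ
    i⇒ii U = unbounded⇒chain (unbounded⇒InI U) U

    i⇒iii : UnboundedReach x σ → Increasing σ × ∃ λ y → PrIs σ y × y ⊑ x
    i⇒iii U = unbounded⇒increasing (unbounded⇒InI U) U , InI⇒pr σ (unbounded⇒InI U)

    iii⇒ii : Increasing σ × (∃ λ y → PrIs σ y × y ⊑ x) → GrowingChain x σ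
    iii⇒ii (inc , y , pr , y⊑x) = i⇒ii (increasing⇒unbounded (proj₂ (pr x) y⊑x) inc)
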